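{- For $u,v\in\mathbb{P}^*$ we have: (a) $u\sim u^r$; (b) if $u\sim v$ then $1u\sim 1v$; (c) if $u\sim v$ then $u^+\sim v^+$.
   Context: $\mathbb{P}$ is the positive integers; $\mathbb{P}^*$ the finite words over $\mathbb{P}$. Generalized factor order: $u\le w$ iff there is a factor $w'$ of $w$ (consecutive letters) with $|w'|=|u|$ and $u_i\le w'_i$ for all $i$. The weight of $w=w_1\cdots w_\ell$ is $t^\ell x^{w_1+\cdots+w_\ell}$ and $F(u;t,x)=\sum_{w\ge u}\mathrm{wt}(w)$. Words $u,v$ are Wilf equivalent, $u\sim v$, if $F(u;t,x)=F(v;t,x)$. For $u=u_1\cdots u_\ell$: $u^r=u_\ell\cdots u_1$ is the reversal; $1u$ is $u$ with the letter 1 prepended; $u^+$ is obtained by adding 1 to every letter of $u$. -}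

module Defs where

open import Data.Nat using (ℕ; zero; suc; _≤_; _∸_)
open import Data.Nat.Properties using (_≤?_)
open import Data.List using (List; []; _∷_; map; concatMap; upTo; filter; length; reverse)
open import Data.List.Relation.Unary.All using (All)
open import Data.List.Relation.Binary.Infix.Heterogeneous using (Infix)
open import Data.List.Relation.Binary.Infix.Heterogeneous.Properties using (infix?)
open import Relation.Binary.PropositionalEquality using (_≡_)
open import Relation.Nullary using (Dec)

-- Words over ℙ are lists of naturals all of whose letters are ≥ 1
-- (positivity is imposed as a hypothesis `PWord`).
Word : Set
Word = List ℕ

PWord : Word → Set
PWord = All (1 ≤_)

-- Generalized factor order: u ≼ w iff u is pointwise ≤ some factor
-- (consecutive block) of w.  This is exactly stdlib's `Infix _≤_`.
_≼_ : Word → Word → Set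
u ≼ w = Infix _≤_ u w

_≼?_ : (u w : Word) → Dec (u ≼ w)
u ≼? w = infix? _≤?_ u w

-- comps ℓ n : the list of all words over ℙ of length ℓ with letter sum n
-- (each listed exactly once).  First letter is suc k with k < n.
comps : ℕ → ℕ → List Word
comps zero    zero    = [] ∷ []
comps zero    (suc n) = []
comps (suc ℓ) n       = concatMap (λ k → map (suc k ∷_) (comps ℓ (n ∸ suc k))) (upTo n)

-- F u ℓ n : the coefficient of t^ℓ x^n in F(u;t,x) = Σ_{w ≥ u} t^|w| x^{Σw},
-- i.e. the number of words w ∈ ℙ* of length ℓ and sum n with u ≼ w.
F : Word → ℕ → ℕ → ℕ
F u ℓ n = length (filter (u ≼?_) (comps ℓ n))

-- Wilf equivalence: equality of the generating functions, i.e. of all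
-- coefficients (equality of formal power series in t, x).
_∼_ : Word → Word → Set
u ∼ v = ∀ ℓ n → F u ℓ n ≡ F v ℓ n

_ʳ : Word → Word
u ʳ = reverse u

one∷ : Word → Word
one∷ u = 1 ∷ u

_⁺ : Word → Word
u ⁺ = map suc u

-- (a) Reversal permutes the words of each length and sum, and u ≤ w iff uʳ ≤ wʳ.
-- (b) For a positive word c w, 1u ≤ c w iff u ≤ w; splitting off the first letter
-- expresses every coefficient of F(1u) through those of F(u).
-- (c) Count the words avoiding u⁺ instead. All letters of u⁺ are at least 2, so no
-- occurrence of u⁺ covers a 1: cutting a word at its first 1 gives w = b 1 r with all
-- letters of b at least 2, and w avoids u⁺ iff b and r do. Such b are exactly the c⁺,
-- and c⁺ avoids u⁺ iff c avoids u. So the avoider counts of u⁺ satisfy a recurrence in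
-- the length whose coefficients are the avoider counts of u, which F(u) determines.

module Submission where

open import Defs
open import Data.Bool using (Bool; true; false; _∧_; _∨_; not)
open import Data.Bool.ListAction using (all)
open import Data.Bool.Properties using (∧-assoc; ∧-zeroʳ)
open import Data.Empty using (⊥-elim)
open import Data.List using (List; []; _∷_; _++_; [_]; map; concatMap; applyUpTo; length; filter; reverse)
open import Data.List.Properties using (reverse-involutive; unfold-reverse; reverse-++; ++-assoc)
open import Data.List.Relation.Unary.All using (All; []; _∷_)
import Data.List.Relation.Unary.All as All
import Data.List.Relation.Unary.All.Properties as Allₚ
open import Data.List.Relation.Binary.Infix.Heterogeneous
  using (Infix; here; there; MkView; toView; fromView; _++ⁱ_; _ⁱ++_)
import Data.List.Relation.Binary.Infix.Heterogeneous as Infix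
import Data.List.Relation.Binary.Infix.Heterogeneous.Properties as Infixₚ
import Data.List.Relation.Binary.Pointwise as Pointwise
open import Data.List.Relation.Binary.Prefix.Heterogeneous using (Prefix; []; _∷_)
open import Data.Nat
open import Data.Nat.Induction using (<-rec)
open import Data.Nat.Properties
open import Algebra.Properties.CommutativeSemigroup +-commutativeSemigroup using (interchange)
open import Data.Product using (_×_; _,_)
open import Data.Sum using (_⊎_; inj₁; inj₂; map₁)
open import Function.Bundles using (mk⇔)
open import Level using (Level)
open import Relation.Binary.Core using (REL)
open import Relation.Binary.PropositionalEquality hiding ([_])
open import Relation.Nullary using (Dec; does; ¬_)
open import Relation.Nullary.Decidable using (does-⇔; _⊎-dec_)

private
  variable
    a b r : Level
    A : Set a
    B : Set b
    R : REL A B r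

𝟙 : Bool → ℕ
𝟙 true  = 1
𝟙 false = 0

𝟙-∧ : ∀ x y → 𝟙 (x ∧ y) ≡ 𝟙 x * 𝟙 y
𝟙-∧ true  y = sym (+-identityʳ (𝟙 y))
𝟙-∧ false y = refl

∑ : List Word → (Word → ℕ) → ℕ
∑ []       f = 0
∑ (w ∷ ws) f = f w + ∑ ws f

syntax ∑ ws (λ w → e) = ∑[ w ∈ ws ] e

∑< : ℕ → (ℕ → ℕ) → ℕ
∑< zero    f = 0
∑< (suc n) f = f 0 + ∑< n (λ i → f (suc i))

syntax ∑< n (λ i → e) = ∑[ i < n ] e

∑-++ : ∀ xs ys f → ∑ (xs ++ ys) f ≡ ∑ xs f + ∑ ys f
∑-++ []       ys f = refl
∑-++ (x ∷ xs) ys f = trans (cong (f x +_) (∑-++ xs ys f)) (sym (+-assoc (f x) _ _))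

∑-map : ∀ (g : Word → Word) xs f → ∑ (map g xs) f ≡ ∑[ w ∈ xs ] f (g w)
∑-map g []       f = refl
∑-map g (x ∷ xs) f = cong (f (g x) +_) (∑-map g xs f)

∑-cong : ∀ {f g : Word → ℕ} → (∀ w → f w ≡ g w) → ∀ xs → ∑ xs f ≡ ∑ xs g
∑-cong f≗g []       = refl
∑-cong f≗g (x ∷ xs) = cong₂ _+_ (f≗g x) (∑-cong f≗g xs)

∑-zero : ∀ xs → ∑[ w ∈ xs ] 0 ≡ 0
∑-zero []       = refl
∑-zero (x ∷ xs) = ∑-zero xs

∑-+ : ∀ xs f g → ∑[ w ∈ xs ] (f w + g w) ≡ ∑ xs f + ∑ xs g
∑-+ []       f g = refl
∑-+ (x ∷ xs) f g = trans (cong (f x + g x +_) (∑-+ xs f g)) (interchange (f x) (g x) _ _)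

∑-*ˡ : ∀ c xs f → ∑[ w ∈ xs ] (c * f w) ≡ c * ∑ xs f
∑-*ˡ c []       f = sym (*-zeroʳ c)
∑-*ˡ c (x ∷ xs) f = trans (cong (c * f x +_) (∑-*ˡ c xs f)) (sym (*-distribˡ-+ c (f x) _))

∑-*ʳ : ∀ c xs f → ∑[ w ∈ xs ] (f w * c) ≡ ∑ xs f * c
∑-*ʳ c []       f = refl
∑-*ʳ c (x ∷ xs) f = trans (cong (f x * c +_) (∑-*ʳ c xs f)) (sym (*-distribʳ-+ c (f x) _))

∑-𝟙+∑-𝟙-not : ∀ (p : Word → Bool) xs →
              ∑[ w ∈ xs ] 𝟙 (p w) + ∑[ w ∈ xs ] 𝟙 (not (p w)) ≡ length xs
∑-𝟙+∑-𝟙-not p []       = refl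
∑-𝟙+∑-𝟙-not p (w ∷ xs) with p w
... | true  = cong suc (∑-𝟙+∑-𝟙-not p xs)
... | false = trans (+-suc _ _) (cong suc (∑-𝟙+∑-𝟙-not p xs))

length-filter≡∑-𝟙 : ∀ {P : Word → Set} (P? : ∀ w → Dec (P w)) xs →
                    length (filter P? xs) ≡ ∑[ w ∈ xs ] 𝟙 (does (P? w))
length-filter≡∑-𝟙 P? []       = refl
length-filter≡∑-𝟙 P? (x ∷ xs) with does (P? x)
... | true  = cong suc (length-filter≡∑-𝟙 P? xs)
... | false = length-filter≡∑-𝟙 P? xs

∑<-cong : ∀ n {f g : ℕ → ℕ} → (∀ i → i < n → f i ≡ g i) → ∑< n f ≡ ∑< n g
∑<-cong zero    f≗g = refl
∑<-cong (suc n) f≗g = cong₂ _+_ (f≗g 0 (s≤s z≤n)) (∑<-cong n (λ i i<n → f≗g (suc i) (s≤s i<n)))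

∑<-zero : ∀ n {f : ℕ → ℕ} → (∀ i → i < n → f i ≡ 0) → ∑< n f ≡ 0
∑<-zero zero    f≗0 = refl
∑<-zero (suc n) f≗0 = cong₂ _+_ (f≗0 0 (s≤s z≤n)) (∑<-zero n (λ i i<n → f≗0 (suc i) (s≤s i<n)))

∑<-+ : ∀ n (f g : ℕ → ℕ) → ∑[ i < n ] (f i + g i) ≡ ∑< n f + ∑< n g
∑<-+ zero    f g = refl
∑<-+ (suc n) f g =
  trans (cong (f 0 + g 0 +_) (∑<-+ n (λ i → f (suc i)) (λ i → g (suc i)))) (interchange (f 0) (g 0) _ _)

∑<-suc : ∀ n (f : ℕ → ℕ) → ∑< (suc n) f ≡ ∑< n f + f n
∑<-suc zero    f = +-comm (f 0) 0
∑<-suc (suc n) f = trans (cong (f 0 +_) (∑<-suc n (λ i → f (suc i)))) (sym (+-assoc (f 0) _ _))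

∑<-reverse : ∀ n (f : ℕ → ℕ) → ∑< n f ≡ ∑[ i < n ] f (n ∸ suc i)
∑<-reverse zero    f = refl
∑<-reverse (suc n) f = trans (∑<-suc n f) (trans (cong (_+ f n) (∑<-reverse n f)) (+-comm _ (f n)))

∑<-trim : ∀ n m (f : ℕ → ℕ) → m ≤ n → (∀ i → m ≤ i → i < n → f i ≡ 0) → ∑< n f ≡ ∑< m f
∑<-trim n       zero    f _   f≗0 = ∑<-zero n (λ i → f≗0 i z≤n)
∑<-trim (suc n) (suc m) f m≤n f≗0 =
  cong (f 0 +_) (∑<-trim n m (λ i → f (suc i)) (s≤s⁻¹ m≤n)
                          (λ i m≤i i<n → f≗0 (suc i) (s≤s m≤i) (s≤s i<n)))

-- Both sides run over the i, t, m with i + 1 + t + m = n.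
∑<-triangle : ∀ n (K : ℕ → ℕ → ℕ → ℕ) →
              ∑[ i < n ] ∑[ t < suc (n ∸ suc i) ] K i t (n ∸ suc i ∸ t)
              ≡ ∑[ s < suc n ] ∑[ i < s ] K i (s ∸ suc i) (n ∸ s)
∑<-triangle zero    K = refl
∑<-triangle (suc n) K =
  trans (cong (∑[ t < suc n ] K 0 t (n ∸ t) +_) (∑<-triangle n (λ i → K (suc i))))
        (sym (∑<-+ (suc n) (λ s → K 0 s (n ∸ s)) (λ s → ∑[ i < s ] K (suc i) (s ∸ suc i) (n ∸ s))))

∑-∑<-comm : ∀ xs m (h : ℕ → Word → ℕ) → ∑[ w ∈ xs ] ∑[ j < m ] h j w ≡ ∑[ j < m ] ∑ xs (h j)
∑-∑<-comm xs zero    h = ∑-zero xs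
∑-∑<-comm xs (suc m) h = trans (∑-+ xs (h 0) (λ w → ∑[ j < m ] h (suc j) w))
                                (cong (∑ xs (h 0) +_) (∑-∑<-comm xs m (λ j → h (suc j))))

∑-concatMap-applyUpTo : ∀ (f : ℕ → List Word) (g : ℕ → ℕ) n h →
                        ∑ (concatMap f (applyUpTo g n)) h ≡ ∑[ i < n ] ∑ (f (g i)) h
∑-concatMap-applyUpTo f g zero    h = refl
∑-concatMap-applyUpTo f g (suc n) h =
  trans (∑-++ (f (g 0)) _ h) (cong (∑ (f (g 0)) h +_) (∑-concatMap-applyUpTo f (λ i → g (suc i)) n h))

-- Sums over compositions

∑-comps-suc : ∀ ℓ n h → ∑ (comps (suc ℓ) n) h ≡ ∑[ a < n ] ∑[ w ∈ comps ℓ (n ∸ suc a) ] h (suc a ∷ w)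
∑-comps-suc ℓ n h =
  trans (∑-concatMap-applyUpTo (λ k → map (suc k ∷_) (comps ℓ (n ∸ suc k))) (λ i → i) n h)
        (∑<-cong n (λ a _ → ∑-map (suc a ∷_) (comps ℓ (n ∸ suc a)) h))

∑-comps-cong : ∀ ℓ n {f g : Word → ℕ} → (∀ w → length w ≡ ℓ → PWord w → f w ≡ g w) →
               ∑ (comps ℓ n) f ≡ ∑ (comps ℓ n) g
∑-comps-cong zero    zero    f≗g = cong (_+ 0) (f≗g [] refl [])
∑-comps-cong zero    (suc n) f≗g = refl
∑-comps-cong (suc ℓ) n {f} {g} f≗g = begin
  ∑ (comps (suc ℓ) n) f
    ≡⟨ ∑-comps-suc ℓ n f ⟩
  ∑[ a < n ] ∑[ w ∈ comps ℓ (n ∸ suc a) ] f (suc a ∷ w)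
    ≡⟨ ∑<-cong n (λ a _ → ∑-comps-cong ℓ (n ∸ suc a)
                            (λ w |w| pw → f≗g (suc a ∷ w) (cong suc |w|) (s≤s z≤n ∷ pw))) ⟩
  ∑[ a < n ] ∑[ w ∈ comps ℓ (n ∸ suc a) ] g (suc a ∷ w)
    ≡⟨ ∑-comps-suc ℓ n g ⟨
  ∑ (comps (suc ℓ) n) g ∎
  where open ≡-Reasoning

∑-comps-< : ∀ ℓ n h → n < ℓ → ∑ (comps ℓ n) h ≡ 0
∑-comps-< (suc ℓ) zero    h _   = refl
∑-comps-< (suc ℓ) (suc n) h n<ℓ =
  trans (∑-comps-suc ℓ (suc n) h)
        (∑<-zero (suc n) (λ a _ → ∑-comps-< ℓ (n ∸ a) (λ w → h (suc a ∷ w))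
                                              (≤-<-trans (m∸n≤m n a) (s≤s⁻¹ n<ℓ))))

∑-comps-++ : ∀ j k n h → ∑ (comps (j + k) n) h
             ≡ ∑[ s < suc n ] ∑[ b ∈ comps j s ] ∑[ c ∈ comps k (n ∸ s) ] h (b ++ c)
∑-comps-++ zero    k n h = sym (trans (cong₂ _+_ (+-identityʳ _) (∑<-zero n (λ _ _ → refl))) (+-identityʳ _))
∑-comps-++ (suc j) k n h = begin
  ∑ (comps (suc j + k) n) h
    ≡⟨ ∑-comps-suc (j + k) n h ⟩
  ∑[ a < n ] ∑[ w ∈ comps (j + k) (n ∸ suc a) ] h (suc a ∷ w)
    ≡⟨ ∑<-cong n (λ a _ → ∑-comps-++ j k (n ∸ suc a) (λ w → h (suc a ∷ w))) ⟩
  ∑[ a < n ] ∑[ t < suc (n ∸ suc a) ] K a t (n ∸ suc a ∸ t)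
    ≡⟨ ∑<-triangle n K ⟩
  ∑[ s < suc n ] ∑[ a < s ] K a (s ∸ suc a) (n ∸ s)
    ≡⟨ ∑<-cong (suc n) (λ s _ → ∑-comps-suc j s (λ b → ∑[ c ∈ comps k (n ∸ s) ] h (b ++ c))) ⟨
  ∑[ s < suc n ] ∑[ b ∈ comps (suc j) s ] ∑[ c ∈ comps k (n ∸ s) ] h (b ++ c) ∎
  where
  open ≡-Reasoning
  K : ℕ → ℕ → ℕ → ℕ
  K a t m = ∑[ b ∈ comps j t ] ∑[ c ∈ comps k m ] h (suc a ∷ b ++ c)

∑-comps-1 : ∀ m (g : Word → ℕ) → ∑ (comps 1 (suc m)) g ≡ g [ suc m ]
∑-comps-1 m g = begin
  ∑ (comps 1 (suc m)) g
    ≡⟨ ∑-comps-suc 0 (suc m) g ⟩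
  ∑[ a < suc m ] ∑[ w ∈ comps 0 (m ∸ a) ] g (suc a ∷ w)
    ≡⟨ ∑<-suc m (λ a → ∑[ w ∈ comps 0 (m ∸ a) ] g (suc a ∷ w)) ⟩
  ∑[ a < m ] ∑[ w ∈ comps 0 (m ∸ a) ] g (suc a ∷ w) + ∑[ w ∈ comps 0 (m ∸ m) ] g (suc m ∷ w)
    ≡⟨ cong₂ _+_ (∑<-zero m empty) (cong (λ k → ∑[ w ∈ comps 0 k ] g (suc m ∷ w)) (n∸n≡0 m)) ⟩
  g [ suc m ] + 0
    ≡⟨ +-identityʳ _ ⟩
  g [ suc m ] ∎
  where
  open ≡-Reasoning
  empty : ∀ a → a < m → ∑[ w ∈ comps 0 (m ∸ a) ] g (suc a ∷ w) ≡ 0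
  empty a a<m = cong (λ k → ∑[ w ∈ comps 0 k ] g (suc a ∷ w)) (+-∸-assoc 1 a<m)

∑-comps-snoc : ∀ ℓ n h →
               ∑ (comps (suc ℓ) n) h ≡ ∑[ a < n ] ∑[ w ∈ comps ℓ (n ∸ suc a) ] h (w ++ [ suc a ])
∑-comps-snoc ℓ n h = begin
  ∑ (comps (suc ℓ) n) h
    ≡⟨ cong (λ k → ∑ (comps k n) h) (+-comm 1 ℓ) ⟩
  ∑ (comps (ℓ + 1) n) h
    ≡⟨ ∑-comps-++ ℓ 1 n h ⟩
  ∑[ s < suc n ] φ s (n ∸ s)
    ≡⟨ ∑<-reverse (suc n) (λ s → φ s (n ∸ s)) ⟩
  ∑[ i < suc n ] φ (n ∸ i) (n ∸ (n ∸ i))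
    ≡⟨ ∑<-cong (suc n) (λ i i≤n → cong (φ (n ∸ i)) (m∸[m∸n]≡n (s≤s⁻¹ i≤n))) ⟩
  ∑[ i < suc n ] φ (n ∸ i) i
    ≡⟨ cong₂ _+_ (∑-zero (comps ℓ n)) (∑<-cong n (λ a _ → ∑-cong (λ b → ∑-comps-1 a (λ c → h (b ++ c)))
                                                                (comps ℓ (n ∸ suc a)))) ⟩
  ∑[ a < n ] ∑[ w ∈ comps ℓ (n ∸ suc a) ] h (w ++ [ suc a ]) ∎
  where
  open ≡-Reasoning
  φ : ℕ → ℕ → ℕ
  φ s m = ∑[ b ∈ comps ℓ s ] ∑[ c ∈ comps 1 m ] h (b ++ c)

∑-comps-reverse : ∀ ℓ n h → ∑ (comps ℓ n) h ≡ ∑[ w ∈ comps ℓ n ] h (reverse w)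
∑-comps-reverse zero    zero    h = refl
∑-comps-reverse zero    (suc n) h = refl
∑-comps-reverse (suc ℓ) n       h = begin
  ∑ (comps (suc ℓ) n) h
    ≡⟨ ∑-comps-snoc ℓ n h ⟩
  ∑[ a < n ] ∑[ w ∈ comps ℓ (n ∸ suc a) ] h (w ++ [ suc a ])
    ≡⟨ ∑<-cong n (λ a _ → ∑-cong (λ w → cong h (snoc≡reverse-∷ a w)) (comps ℓ (n ∸ suc a))) ⟩
  ∑[ a < n ] ∑[ w ∈ comps ℓ (n ∸ suc a) ] h (reverse (suc a ∷ reverse w))
    ≡⟨ ∑<-cong n (λ a _ → ∑-comps-reverse ℓ (n ∸ suc a) (λ w → h (reverse (suc a ∷ w)))) ⟨
  ∑[ a < n ] ∑[ w ∈ comps ℓ (n ∸ suc a) ] h (reverse (suc a ∷ w))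
    ≡⟨ ∑-comps-suc ℓ n (λ w → h (reverse w)) ⟨
  ∑[ w ∈ comps (suc ℓ) n ] h (reverse w) ∎
  where
  open ≡-Reasoning
  snoc≡reverse-∷ : ∀ a w → w ++ [ suc a ] ≡ reverse (suc a ∷ reverse w)
  snoc≡reverse-∷ a w =
    trans (cong (_++ [ suc a ]) (sym (reverse-involutive w))) (sym (unfold-reverse (suc a) (reverse w)))

≥2ᵇ : ℕ → Bool
≥2ᵇ (suc (suc _)) = true
≥2ᵇ _             = false

∑-comps-all≥2 : ∀ j s (h : Word → ℕ) →
                ∑[ b ∈ comps j s ] (𝟙 (all ≥2ᵇ b) * h b) ≡ ∑[ c ∈ comps j (s ∸ j) ] h (map suc c)
∑-comps-all≥2 zero    zero    h = cong (_+ 0) (+-identityʳ (h []))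
∑-comps-all≥2 zero    (suc s) h = refl
∑-comps-all≥2 (suc j) zero    h = refl
∑-comps-all≥2 (suc j) (suc s) h = begin
  ∑[ b ∈ comps (suc j) (suc s) ] (𝟙 (all ≥2ᵇ b) * h b)
    ≡⟨ ∑-comps-suc j (suc s) _ ⟩
  ∑[ w ∈ comps j s ] 0 + ∑[ a < s ] f a
    ≡⟨ cong₂ _+_ (∑-zero (comps j s)) (∑<-trim s (s ∸ j) f (m∸n≤m s j) f-vanishes) ⟩
  ∑[ a < s ∸ j ] f a
    ≡⟨ ∑<-cong (s ∸ j) (λ a _ → ∑-comps-all≥2 j (s ∸ suc a) (λ w → h (suc (suc a) ∷ w))) ⟩
  ∑[ a < s ∸ j ] ∑[ c ∈ comps j (s ∸ suc a ∸ j) ] h (suc (suc a) ∷ map suc c)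
    ≡⟨ ∑<-cong (s ∸ j) (λ a _ → cong (λ k → ∑[ c ∈ comps j k ] h (suc (suc a) ∷ map suc c))
                                     (∸-comm s j a)) ⟩
  ∑[ a < s ∸ j ] ∑[ c ∈ comps j (s ∸ j ∸ suc a) ] h (suc (suc a) ∷ map suc c)
    ≡⟨ ∑-comps-suc j (s ∸ j) _ ⟨
  ∑[ c ∈ comps (suc j) (s ∸ j) ] h (map suc c) ∎
  where
  open ≡-Reasoning
  f : ℕ → ℕ
  f a = ∑[ w ∈ comps j (s ∸ suc a) ] (𝟙 (all ≥2ᵇ w) * h (suc (suc a) ∷ w))
  f-vanishes : ∀ a → s ∸ j ≤ a → a < s → f a ≡ 0
  f-vanishes a s∸j≤a a<s =
    ∑-comps-< j (s ∸ suc a) _ (subst (s ∸ suc a <_) (m+n∸n≡m j (suc a)) (∸-monoˡ-< s<j+1+a a<s))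
    where
    s<j+1+a : s < j + suc a
    s<j+1+a = ≤-<-trans (≤-trans (m≤n+m∸n s j) (+-monoʳ-≤ j s∸j≤a)) (+-monoʳ-< j (n<1+n a))
  ∸-comm : ∀ s j a → s ∸ suc a ∸ j ≡ s ∸ j ∸ suc a
  ∸-comm s j a =
    trans (∸-+-assoc s (suc a) j) (trans (cong (s ∸_) (+-comm (suc a) j)) (sym (∸-+-assoc s j (suc a))))

Infix-tail : ∀ {x xs ys} → Infix R (x ∷ xs) ys → Infix R xs ys
Infix-tail (here (_ ∷ p)) = there (here p)
Infix-tail (there i)      = there (Infix-tail i)

Infix-∷⁻ : ∀ {x xs y ys} → Infix R (x ∷ xs) (y ∷ ys) → Infix R xs ys
Infix-∷⁻ (here (_ ∷ p)) = here p
Infix-∷⁻ (there i)      = Infix-tail i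

Infix-reverse⁺ : ∀ {xs ys} → Infix R xs ys → Infix R (reverse xs) (reverse ys)
Infix-reverse⁺ {R = R} {xs = xs} i with toView i
... | MkView pre {inf} pw suf =
  subst (Infix R (reverse xs)) (sym reverse-split)
        (fromView (MkView (reverse suf) (Pointwise.reverse⁺ pw) (reverse pre)))
  where
  reverse-split : reverse (pre ++ inf ++ suf) ≡ reverse suf ++ reverse inf ++ reverse pre
  reverse-split = trans (reverse-++ pre (inf ++ suf))
                        (trans (cong (_++ reverse pre) (reverse-++ inf suf))
                               (++-assoc (reverse suf) (reverse inf) (reverse pre)))

Prefix-++-∷⁻ : ∀ {xs} ys {c zs} → All (λ x → ¬ R x c) xs → Prefix R xs (ys ++ c ∷ zs) → Prefix R xs ys
Prefix-++-∷⁻ []       _          []        = []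
Prefix-++-∷⁻ []       (x≰c ∷ _)  (x≤c ∷ _) = ⊥-elim (x≰c x≤c)
Prefix-++-∷⁻ (y ∷ ys) _          []        = []
Prefix-++-∷⁻ (y ∷ ys) (_ ∷ xs≰c) (x≤y ∷ p) = x≤y ∷ Prefix-++-∷⁻ ys xs≰c p

Infix-++-∷⁻ : ∀ {xs} ys {c zs} → All (λ x → ¬ R x c) xs →
              Infix R xs (ys ++ c ∷ zs) → Infix R xs ys ⊎ Infix R xs zs
Infix-++-∷⁻ []       xs≰c (here p)  = inj₁ (here (Prefix-++-∷⁻ [] xs≰c p))
Infix-++-∷⁻ []       xs≰c (there i) = inj₂ i
Infix-++-∷⁻ (y ∷ ys) xs≰c (here p)  = inj₁ (here (Prefix-++-∷⁻ (y ∷ ys) xs≰c p))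
Infix-++-∷⁻ (y ∷ ys) xs≰c (there i) = map₁ there (Infix-++-∷⁻ ys xs≰c i)

-- Reversal and prepending 1

_≼ᵇ_ : Word → Word → Bool
u ≼ᵇ w = does (u ≼? w)

F≡∑ : ∀ u ℓ n → F u ℓ n ≡ ∑[ w ∈ comps ℓ n ] 𝟙 (u ≼ᵇ w)
F≡∑ u ℓ n = length-filter≡∑-𝟙 (u ≼?_) (comps ℓ n)

≼ᵇ-reverse : ∀ u w → u ≼ᵇ reverse w ≡ reverse u ≼ᵇ w
≼ᵇ-reverse u w = does-⇔ (mk⇔ to from) (u ≼? reverse w) (reverse u ≼? w)
  where
  to : u ≼ reverse w → reverse u ≼ w
  to i = subst (Infix _≤_ (reverse u)) (reverse-involutive w) (Infix-reverse⁺ i)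
  from : reverse u ≼ w → u ≼ reverse w
  from i = subst (λ x → x ≼ reverse w) (reverse-involutive u) (Infix-reverse⁺ i)

∼-reverse : ∀ u → u ∼ (u ʳ)
∼-reverse u ℓ n = begin
  F u ℓ n
    ≡⟨ F≡∑ u ℓ n ⟩
  ∑[ w ∈ comps ℓ n ] 𝟙 (u ≼ᵇ w)
    ≡⟨ ∑-comps-reverse ℓ n (λ w → 𝟙 (u ≼ᵇ w)) ⟩
  ∑[ w ∈ comps ℓ n ] 𝟙 (u ≼ᵇ reverse w)
    ≡⟨ ∑-cong (λ w → cong 𝟙 (≼ᵇ-reverse u w)) (comps ℓ n) ⟩
  ∑[ w ∈ comps ℓ n ] 𝟙 (reverse u ≼ᵇ w)
    ≡⟨ F≡∑ (u ʳ) ℓ n ⟨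
  F (u ʳ) ℓ n ∎
  where open ≡-Reasoning

one∷-≼-∷ : ∀ {u c w} → 1 ≤ c → PWord w → u ≼ w → one∷ u ≼ (c ∷ w)
one∷-≼-∷ 1≤c _           (here p)  = here (1≤c ∷ p)
one∷-≼-∷ _   (1≤c′ ∷ pw) (there i) = there (one∷-≼-∷ 1≤c′ pw i)

one∷-≼ᵇ-∷ : ∀ u {c} w → 1 ≤ c → PWord w → one∷ u ≼ᵇ (c ∷ w) ≡ u ≼ᵇ w
one∷-≼ᵇ-∷ u {c} w 1≤c pw =
  does-⇔ (mk⇔ Infix-∷⁻ (one∷-≼-∷ 1≤c pw)) (one∷ u ≼? (c ∷ w)) (u ≼? w)

F-one∷ : ∀ u ℓ n → F (one∷ u) (suc ℓ) n ≡ ∑[ a < n ] F u ℓ (n ∸ suc a)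
F-one∷ u ℓ n = begin
  F (one∷ u) (suc ℓ) n
    ≡⟨ F≡∑ (one∷ u) (suc ℓ) n ⟩
  ∑[ w ∈ comps (suc ℓ) n ] 𝟙 (one∷ u ≼ᵇ w)
    ≡⟨ ∑-comps-suc ℓ n (λ w → 𝟙 (one∷ u ≼ᵇ w)) ⟩
  ∑[ a < n ] ∑[ w ∈ comps ℓ (n ∸ suc a) ] 𝟙 (one∷ u ≼ᵇ (suc a ∷ w))
    ≡⟨ ∑<-cong n (λ a _ → drop-one a) ⟩
  ∑[ a < n ] F u ℓ (n ∸ suc a) ∎
  where
  open ≡-Reasoning
  drop-one : ∀ a → ∑[ w ∈ comps ℓ (n ∸ suc a) ] 𝟙 (one∷ u ≼ᵇ (suc a ∷ w)) ≡ F u ℓ (n ∸ suc a)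
  drop-one a = trans (∑-comps-cong ℓ (n ∸ suc a) (λ w _ pw → cong 𝟙 (one∷-≼ᵇ-∷ u {suc a} w (s≤s z≤n) pw)))
                     (sym (F≡∑ u ℓ (n ∸ suc a)))

∼-one∷ : ∀ {u v} → u ∼ v → one∷ u ∼ one∷ v
∼-one∷         u∼v zero    zero    = refl
∼-one∷         u∼v zero    (suc n) = refl
∼-one∷ {u} {v} u∼v (suc ℓ) n       = begin
  F (one∷ u) (suc ℓ) n          ≡⟨ F-one∷ u ℓ n ⟩
  ∑[ a < n ] F u ℓ (n ∸ suc a)  ≡⟨ ∑<-cong n (λ a _ → u∼v ℓ (n ∸ suc a)) ⟩
  ∑[ a < n ] F v ℓ (n ∸ suc a)  ≡⟨ F-one∷ v ℓ n ⟨
  F (one∷ v) (suc ℓ) n          ∎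
  where open ≡-Reasoning

-- Avoiders of u⁺

avoids : Word → Word → Bool
avoids u w = not (u ≼ᵇ w)

avoiders : Word → ℕ → ℕ → ℕ
avoiders u ℓ n = ∑[ w ∈ comps ℓ n ] 𝟙 (avoids u w)

F+avoiders : ∀ u ℓ n → F u ℓ n + avoiders u ℓ n ≡ length (comps ℓ n)
F+avoiders u ℓ n = trans (cong (_+ avoiders u ℓ n) (F≡∑ u ℓ n)) (∑-𝟙+∑-𝟙-not (u ≼ᵇ_) (comps ℓ n))

avoiders-cong : ∀ {u v} → u ∼ v → ∀ ℓ n → avoiders u ℓ n ≡ avoiders v ℓ n
avoiders-cong {u} {v} u∼v ℓ n = +-cancelˡ-≡ (F u ℓ n) _ _ (begin
  F u ℓ n + avoiders u ℓ n  ≡⟨ F+avoiders u ℓ n ⟩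
  length (comps ℓ n)        ≡⟨ F+avoiders v ℓ n ⟨
  F v ℓ n + avoiders v ℓ n  ≡⟨ cong (_+ avoiders v ℓ n) (u∼v ℓ n) ⟨
  F u ℓ n + avoiders v ℓ n  ∎)
  where open ≡-Reasoning

∼-from-avoiders : ∀ {u v} → (∀ ℓ n → avoiders u ℓ n ≡ avoiders v ℓ n) → u ∼ v
∼-from-avoiders {u} {v} eq ℓ n = +-cancelʳ-≡ (avoiders u ℓ n) _ _ (begin
  F u ℓ n + avoiders u ℓ n  ≡⟨ F+avoiders u ℓ n ⟩
  length (comps ℓ n)        ≡⟨ F+avoiders v ℓ n ⟨
  F v ℓ n + avoiders v ℓ n  ≡⟨ cong (F v ℓ n +_) (eq ℓ n) ⟨
  F v ℓ n + avoiders u ℓ n  ∎)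
  where open ≡-Reasoning

avoids-⁺-map-suc : ∀ u c → avoids (u ⁺) (map suc c) ≡ avoids u c
avoids-⁺-map-suc u c = cong not (does-⇔ (mk⇔ to from) ((u ⁺) ≼? map suc c) (u ≼? c))
  where
  to : (u ⁺) ≼ map suc c → u ≼ c
  to i = Infix.map s≤s⁻¹ (Infixₚ.map⁻ suc suc i)
  from : u ≼ c → (u ⁺) ≼ map suc c
  from i = Infixₚ.map⁺ suc suc (Infix.map s≤s i)

≥2ᵇ≡false⇒<2 : ∀ {c} → ≥2ᵇ c ≡ false → c < 2
≥2ᵇ≡false⇒<2 {zero}          _ = s≤s z≤n
≥2ᵇ≡false⇒<2 {suc zero}      _ = s≤s (s≤s z≤n)
≥2ᵇ≡false⇒<2 {suc (suc _)} ()

-- A letter c < 2 cannot lie under an occurrence of u⁺, whose letters are all ≥ 2.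
⁺-≼ᵇ-++-∷ : ∀ {u} → PWord u → ∀ b {c} r → ≥2ᵇ c ≡ false →
            (u ⁺) ≼ᵇ (b ++ c ∷ r) ≡ ((u ⁺) ≼ᵇ b ∨ (u ⁺) ≼ᵇ r)
⁺-≼ᵇ-++-∷ {u} pu b {c} r c-small =
  does-⇔ (mk⇔ (Infix-++-∷⁻ b u⁺≰c) λ { (inj₁ i) → i ⁱ++ (c ∷ r) ; (inj₂ i) → b ++ⁱ there i })
         ((u ⁺) ≼? (b ++ c ∷ r)) (((u ⁺) ≼? b) ⊎-dec ((u ⁺) ≼? r))
  where
  u⁺≰c : All (λ x → ¬ x ≤ c) (u ⁺)
  u⁺≰c = Allₚ.map⁺ (All.map (λ 1≤x 1+x≤c → <⇒≱ (≤-<-trans 1+x≤c (≥2ᵇ≡false⇒<2 c-small)) (s≤s 1≤x)) pu)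

firstSmallAt : ℕ → Word → Bool
firstSmallAt zero    []      = false
firstSmallAt zero    (c ∷ w) = not (≥2ᵇ c)
firstSmallAt (suc j) []      = false
firstSmallAt (suc j) (c ∷ w) = ≥2ᵇ c ∧ firstSmallAt j w

firstSmallAt-partition : ∀ x w → 𝟙 (x ∧ all ≥2ᵇ w) + ∑[ j < length w ] 𝟙 (x ∧ firstSmallAt j w) ≡ 𝟙 x
firstSmallAt-partition true  []      = refl
firstSmallAt-partition false []      = refl
firstSmallAt-partition x     (c ∷ w) with ≥2ᵇ c
firstSmallAt-partition true  (c ∷ w) | true  = firstSmallAt-partition true w
firstSmallAt-partition false (c ∷ w) | true  = firstSmallAt-partition false w
firstSmallAt-partition true  (c ∷ w) | false = cong suc (∑<-zero (length w) (λ _ _ → refl))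
firstSmallAt-partition false (c ∷ w) | false = ∑<-zero (length w) (λ _ _ → refl)

firstSmallAt-++ : ∀ b r → firstSmallAt (length b) (b ++ r) ≡ all ≥2ᵇ b ∧ firstSmallAt 0 r
firstSmallAt-++ []      r = refl
firstSmallAt-++ (c ∷ b) r =
  trans (cong (≥2ᵇ c ∧_) (firstSmallAt-++ b r)) (sym (∧-assoc (≥2ᵇ c) (all ≥2ᵇ b) (firstSmallAt 0 r)))

smallHeadAvoiding : Word → Word → Bool
smallHeadAvoiding u []      = false
smallHeadAvoiding u (c ∷ r) = not (≥2ᵇ c) ∧ avoids (u ⁺) r

avoids-⁺-at-firstSmall : ∀ {u} → PWord u → ∀ b r →
  avoids (u ⁺) (b ++ r) ∧ firstSmallAt (length b) (b ++ r)
  ≡ (avoids (u ⁺) b ∧ all ≥2ᵇ b) ∧ smallHeadAvoiding u r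
avoids-⁺-at-firstSmall {u} pu b r rewrite firstSmallAt-++ b r = split r
  where
  both-false : ∀ x y z → x ∧ (y ∧ false) ≡ z ∧ false
  both-false x y z = trans (cong (x ∧_) (∧-zeroʳ y)) (trans (∧-zeroʳ x) (sym (∧-zeroʳ z)))
  split : ∀ r → avoids (u ⁺) (b ++ r) ∧ (all ≥2ᵇ b ∧ firstSmallAt 0 r)
                ≡ (avoids (u ⁺) b ∧ all ≥2ᵇ b) ∧ smallHeadAvoiding u r
  split []      = both-false (avoids (u ⁺) (b ++ [])) (all ≥2ᵇ b) (avoids (u ⁺) b ∧ all ≥2ᵇ b)
  split (c ∷ r) with ≥2ᵇ c in c≥2
  ... | true  = both-false (avoids (u ⁺) (b ++ c ∷ r)) (all ≥2ᵇ b) (avoids (u ⁺) b ∧ all ≥2ᵇ b)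
  ... | false rewrite ⁺-≼ᵇ-++-∷ pu b r c≥2 with (u ⁺) ≼ᵇ b | (u ⁺) ≼ᵇ r | all ≥2ᵇ b
  ...   | true  | _     | _     = refl
  ...   | false | true  | true  = refl
  ...   | false | true  | false = refl
  ...   | false | false | true  = refl
  ...   | false | false | false = refl

∑-avoids-⁺-all≥2 : ∀ u j s →
                   ∑[ b ∈ comps j s ] 𝟙 (avoids (u ⁺) b ∧ all ≥2ᵇ b) ≡ avoiders u j (s ∸ j)
∑-avoids-⁺-all≥2 u j s = begin
  ∑[ b ∈ comps j s ] 𝟙 (avoids (u ⁺) b ∧ all ≥2ᵇ b)
    ≡⟨ ∑-cong (λ b → trans (𝟙-∧ (avoids (u ⁺) b) (all ≥2ᵇ b)) (*-comm (𝟙 (avoids (u ⁺) b)) (𝟙 (all ≥2ᵇ b))))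
              (comps j s) ⟩
  ∑[ b ∈ comps j s ] (𝟙 (all ≥2ᵇ b) * 𝟙 (avoids (u ⁺) b))
    ≡⟨ ∑-comps-all≥2 j s (λ b → 𝟙 (avoids (u ⁺) b)) ⟩
  ∑[ c ∈ comps j (s ∸ j) ] 𝟙 (avoids (u ⁺) (map suc c))
    ≡⟨ ∑-cong (λ c → cong 𝟙 (avoids-⁺-map-suc u c)) (comps j (s ∸ j)) ⟩
  avoiders u j (s ∸ j) ∎
  where open ≡-Reasoning

∑-smallHeadAvoiding : ∀ u k m → ∑[ r ∈ comps (suc k) (suc m) ] 𝟙 (smallHeadAvoiding u r) ≡ avoiders (u ⁺) k m
∑-smallHeadAvoiding u k m =
  trans (∑-comps-suc k (suc m) (λ r → 𝟙 (smallHeadAvoiding u r)))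
        (trans (cong (avoiders (u ⁺) k m +_) (∑<-zero m (λ a _ → ∑-zero (comps k (m ∸ suc a)))))
               (+-identityʳ _))

∑-avoids-⁺-firstSmallAt : ∀ {u} → PWord u → ∀ j k n →
  ∑[ w ∈ comps (j + suc k) n ] 𝟙 (avoids (u ⁺) w ∧ firstSmallAt j w)
  ≡ ∑[ s < n ] (avoiders u j (s ∸ j) * avoiders (u ⁺) k (n ∸ suc s))
∑-avoids-⁺-firstSmallAt {u} pu j k n = begin
  ∑[ w ∈ comps (j + suc k) n ] 𝟙 (avoids (u ⁺) w ∧ firstSmallAt j w)
    ≡⟨ ∑-comps-++ j (suc k) n (λ w → 𝟙 (avoids (u ⁺) w ∧ firstSmallAt j w)) ⟩
  ∑[ s < suc n ] G s (n ∸ s)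
    ≡⟨ ∑<-suc n (λ s → G s (n ∸ s)) ⟩
  ∑[ s < n ] G s (n ∸ s) + G n (n ∸ n)
    ≡⟨ cong (∑[ s < n ] G s (n ∸ s) +_) (trans (cong (G n) (n∸n≡0 n)) (∑-zero (comps j n))) ⟩
  ∑[ s < n ] G s (n ∸ s) + 0
    ≡⟨ +-identityʳ _ ⟩
  ∑[ s < n ] G s (n ∸ s)
    ≡⟨ ∑<-cong n (λ s s<n → trans (cong (G s) (+-∸-assoc 1 s<n)) (G-factorises s (n ∸ suc s))) ⟩
  ∑[ s < n ] (avoiders u j (s ∸ j) * avoiders (u ⁺) k (n ∸ suc s)) ∎
  where
  open ≡-Reasoning
  avoidingLarge : Word → Bool
  avoidingLarge b = avoids (u ⁺) b ∧ all ≥2ᵇ b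
  G : ℕ → ℕ → ℕ
  G s m = ∑[ b ∈ comps j s ] ∑[ r ∈ comps (suc k) m ] 𝟙 (avoids (u ⁺) (b ++ r) ∧ firstSmallAt j (b ++ r))
  factor-b : ∀ m b → length b ≡ j →
    ∑[ r ∈ comps (suc k) (suc m) ] 𝟙 (avoids (u ⁺) (b ++ r) ∧ firstSmallAt j (b ++ r))
    ≡ 𝟙 (avoidingLarge b) * avoiders (u ⁺) k m
  factor-b m b refl =
    trans (∑-cong (λ r → trans (cong 𝟙 (avoids-⁺-at-firstSmall pu b r))
                               (𝟙-∧ (avoidingLarge b) (smallHeadAvoiding u r)))
                  (comps (suc k) (suc m)))
          (trans (∑-*ˡ (𝟙 (avoidingLarge b)) (comps (suc k) (suc m)) (λ r → 𝟙 (smallHeadAvoiding u r)))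
                 (cong (𝟙 (avoidingLarge b) *_) (∑-smallHeadAvoiding u k m)))
  G-factorises : ∀ s m → G s (suc m) ≡ avoiders u j (s ∸ j) * avoiders (u ⁺) k m
  G-factorises s m =
    trans (∑-comps-cong j s (λ b |b| _ → factor-b m b |b|))
          (trans (∑-*ʳ (avoiders (u ⁺) k m) (comps j s) (λ b → 𝟙 (avoidingLarge b)))
                 (cong (_* avoiders (u ⁺) k m) (∑-avoids-⁺-all≥2 u j s)))

-- For the avoider counts this is Z = B + t x B Z, with Z = Σ ζ ℓ n tˡ xⁿ and B = Σ α ℓ m tˡ x^(ℓ+m).
firstOneRecurrence : (ℕ → ℕ → ℕ) → (ℕ → ℕ → ℕ) → ℕ → ℕ → ℕ
firstOneRecurrence α ζ ℓ n = α ℓ (n ∸ ℓ) + ∑[ j < ℓ ] ∑[ s < n ] (α j (s ∸ j) * ζ (ℓ ∸ suc j) (n ∸ suc s))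

-- The right-hand side at length ℓ uses ζ only at lengths below ℓ.
firstOneRecurrence-unique : ∀ {α α′ ζ ζ′ : ℕ → ℕ → ℕ} → (∀ ℓ n → α ℓ n ≡ α′ ℓ n) →
  (∀ ℓ n → ζ ℓ n ≡ firstOneRecurrence α ζ ℓ n) → (∀ ℓ n → ζ′ ℓ n ≡ firstOneRecurrence α′ ζ′ ℓ n) →
  ∀ ℓ n → ζ ℓ n ≡ ζ′ ℓ n
firstOneRecurrence-unique {α} {α′} {ζ} {ζ′} α≗α′ ζ-rec ζ′-rec = <-rec _ step
  where
  step : ∀ ℓ → (∀ {k} → k < ℓ → ∀ n → ζ k n ≡ ζ′ k n) → ∀ n → ζ ℓ n ≡ ζ′ ℓ n
  step ℓ ih n = begin
    ζ ℓ n
      ≡⟨ ζ-rec ℓ n ⟩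
    firstOneRecurrence α ζ ℓ n
      ≡⟨ cong₂ _+_ (α≗α′ ℓ (n ∸ ℓ)) (∑<-cong ℓ (λ j j<ℓ → ∑<-cong n (λ s _ →
           cong₂ _*_ (α≗α′ j (s ∸ j)) (ih (∸-monoʳ-< (s≤s z≤n) j<ℓ) (n ∸ suc s))))) ⟩
    firstOneRecurrence α′ ζ′ ℓ n
      ≡⟨ ζ′-rec ℓ n ⟨
    ζ′ ℓ n ∎
    where open ≡-Reasoning

avoiders-⁺-recurrence : ∀ {u} → PWord u → ∀ ℓ n →
                        avoiders (u ⁺) ℓ n ≡ firstOneRecurrence (avoiders u) (avoiders (u ⁺)) ℓ n
avoiders-⁺-recurrence {u} pu ℓ n = begin
  avoiders (u ⁺) ℓ n
    ≡⟨ ∑-comps-cong ℓ n (λ w |w| _ → classify w |w|) ⟩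
  ∑[ w ∈ comps ℓ n ] (𝟙 (av w ∧ all ≥2ᵇ w) + ∑[ j < ℓ ] 𝟙 (av w ∧ firstSmallAt j w))
    ≡⟨ ∑-+ (comps ℓ n) (λ w → 𝟙 (av w ∧ all ≥2ᵇ w)) (λ w → ∑[ j < ℓ ] 𝟙 (av w ∧ firstSmallAt j w)) ⟩
  ∑[ w ∈ comps ℓ n ] 𝟙 (av w ∧ all ≥2ᵇ w) + ∑[ w ∈ comps ℓ n ] ∑[ j < ℓ ] 𝟙 (av w ∧ firstSmallAt j w)
    ≡⟨ cong₂ _+_ (∑-avoids-⁺-all≥2 u ℓ n)
                 (∑-∑<-comm (comps ℓ n) ℓ (λ j w → 𝟙 (av w ∧ firstSmallAt j w))) ⟩
  avoiders u ℓ (n ∸ ℓ) + ∑[ j < ℓ ] ∑[ w ∈ comps ℓ n ] 𝟙 (av w ∧ firstSmallAt j w)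
    ≡⟨ cong (avoiders u ℓ (n ∸ ℓ) +_) (∑<-cong ℓ first-small-at) ⟩
  firstOneRecurrence (avoiders u) (avoiders (u ⁺)) ℓ n ∎
  where
  open ≡-Reasoning
  av : Word → Bool
  av = avoids (u ⁺)
  classify : ∀ w → length w ≡ ℓ →
             𝟙 (av w) ≡ 𝟙 (av w ∧ all ≥2ᵇ w) + ∑[ j < ℓ ] 𝟙 (av w ∧ firstSmallAt j w)
  classify w |w| = subst (λ i → 𝟙 (av w) ≡ 𝟙 (av w ∧ all ≥2ᵇ w) + ∑[ j < i ] 𝟙 (av w ∧ firstSmallAt j w))
                         |w| (sym (firstSmallAt-partition (av w) w))
  first-small-at : ∀ j → j < ℓ →
    ∑[ w ∈ comps ℓ n ] 𝟙 (av w ∧ firstSmallAt j w)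
    ≡ ∑[ s < n ] (avoiders u j (s ∸ j) * avoiders (u ⁺) (ℓ ∸ suc j) (n ∸ suc s))
  first-small-at j j<ℓ =
    trans (cong (λ i → ∑[ w ∈ comps i n ] 𝟙 (av w ∧ firstSmallAt j w))
                (sym (trans (+-suc j _) (m+[n∸m]≡n j<ℓ))))
          (∑-avoids-⁺-firstSmallAt pu j (ℓ ∸ suc j) n)

∼-⁺ : ∀ {u v} → PWord u → PWord v → u ∼ v → (u ⁺) ∼ (v ⁺)
∼-⁺ pu pv u∼v = ∼-from-avoiders
  (firstOneRecurrence-unique (avoiders-cong u∼v) (avoiders-⁺-recurrence pu) (avoiders-⁺-recurrence pv))

lemma4p1 : ((u : Word) → PWord u → u ∼ (u ʳ))
           × ((u v : Word) → PWord u → PWord v → u ∼ v → one∷ u ∼ one∷ v)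
           × ((u v : Word) → PWord u → PWord v → u ∼ v → (u ⁺) ∼ (v ⁺))
lemma4p1 = (λ u _ → ∼-reverse u)
         , (λ u v _ _ → ∼-one∷)
         , (λ u v → ∼-⁺)
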